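{- Let $V$ be a finite set and let $\mathcal{F}$ be a disjointness-compliable family of subsets of $V$. Then for any $A,B\in\mathcal{F}$, either $A\cap B\in\mathcal{F}$, or both $A\setminus B\in\mathcal{F}$ and $B\setminus A\in\mathcal{F}$. Consequently, for any $A\in\mathcal{F}$ and any $\mathcal{F}$-core $C$, either $C\subseteq A$ or $C\cap A=\emptyset$. In particular, the $\mathcal{F}$-cores are pairwise disjoint.
   Context: A set family $\mathcal{F}$ is disjointness-compliable if $A'\subseteq A\in\mathcal{F}$ implies $A'\in\mathcal{F}$ or $A\setminus A'\in\mathcal{F}$. An $\mathcal{F}$-core is an inclusion-minimal member of $\mathcal{F}$. -}

module Defs where

open import Level using (Level; suc)
open import Data.Nat using (ℕ)
open import Data.Fin.Subset using (Subset; _⊆_; _─_)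
open import Relation.Binary.PropositionalEquality using (_≡_)

-- The ground set V is modelled as Fin n; a set family on V is a predicate
-- on subsets of Fin n (Subset n = Vec Bool n, i.e. characteristic vectors).
Family : (ℓ : Level) → ℕ → Set (suc ℓ)
Family ℓ n = Subset n → Set ℓ

DisjointnessCompliable : ∀ {ℓ n} → Family ℓ n → Set ℓ
DisjointnessCompliable {n = n} F =
  ∀ (A A' : Subset n) → A' ⊆ A → F A → F A' ⊎ F (A ─ A')
  where open import Data.Sum using (_⊎_)

IsCore : ∀ {ℓ n} → Family ℓ n → Subset n → Set ℓ
IsCore {n = n} F C = F C × (∀ (C' : Subset n) → C' ⊆ C → F C' → C' ≡ C)
  where open import Data.Product using (_×_)

{-# OPTIONS --safe #-}
module Submission where

-- Apply compliability to A ∩ B ⊆ A and to B ∩ A ⊆ B: if neither intersection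
-- lies in F, both differences A ∖ (A ∩ B) = A ∖ B and B ∖ A do. For a core C
-- and A ∈ F, minimality of C then forces C ∩ A = C or C ∖ A = C.

open import Defs
open import Level using (Level)
open import Data.Nat using (ℕ)
open import Data.Bool using (true; false)
open import Data.Vec using ([]; _∷_)
open import Data.Fin.Subset using (Subset; _⊆_; _─_; _∩_; ⊥)
open import Data.Fin.Subset.Properties using (p∩q⊆p; p∩q⊆q; ∩-comm; p─q⊆p)
open import Data.Product using (_×_; _,_)
open import Data.Sum using (_⊎_; inj₁; inj₂)
open import Relation.Nullary using (¬_; contradiction)
open import Relation.Binary.PropositionalEquality using (_≡_; refl; cong; subst)

p─p∩q≡p─q : ∀ {n} (p q : Subset n) → p ─ (p ∩ q) ≡ p ─ q
p─p∩q≡p─q []          []          = refl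
p─p∩q≡p─q (true  ∷ p) (true  ∷ q) = cong (false ∷_) (p─p∩q≡p─q p q)
p─p∩q≡p─q (true  ∷ p) (false ∷ q) = cong (true  ∷_) (p─p∩q≡p─q p q)
p─p∩q≡p─q (false ∷ p) (true  ∷ q) = cong (false ∷_) (p─p∩q≡p─q p q)
p─p∩q≡p─q (false ∷ p) (false ∷ q) = cong (false ∷_) (p─p∩q≡p─q p q)

[p─q]∩q≡⊥ : ∀ {n} (p q : Subset n) → (p ─ q) ∩ q ≡ ⊥
[p─q]∩q≡⊥ []          []          = refl
[p─q]∩q≡⊥ (true  ∷ p) (true  ∷ q) = cong (false ∷_) ([p─q]∩q≡⊥ p q)
[p─q]∩q≡⊥ (true  ∷ p) (false ∷ q) = cong (false ∷_) ([p─q]∩q≡⊥ p q)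
[p─q]∩q≡⊥ (false ∷ p) (true  ∷ q) = cong (false ∷_) ([p─q]∩q≡⊥ p q)
[p─q]∩q≡⊥ (false ∷ p) (false ∷ q) = cong (false ∷_) ([p─q]∩q≡⊥ p q)

module _ {ℓ n} {F : Family ℓ n} where

  core-⊆⇒≡ : ∀ {C D} → IsCore F C → IsCore F D → C ⊆ D → C ≡ D
  core-⊆⇒≡ {C} (C∈F , _) (_ , D-minimal) C⊆D = D-minimal C C⊆D C∈F

  module _ (compliable : DisjointnessCompliable F) where

    ∩∈⊎─∈ : ∀ A B → F A → F B → F (A ∩ B) ⊎ (F (A ─ B) × F (B ─ A))
    ∩∈⊎─∈ A B A∈F B∈F with compliable A (A ∩ B) (p∩q⊆p A B) A∈F
    ... | inj₁ A∩B∈F = inj₁ A∩B∈F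
    ... | inj₂ A─A∩B∈F with compliable B (B ∩ A) (p∩q⊆p B A) B∈F
    ...   | inj₁ B∩A∈F = inj₁ (subst F (∩-comm B A) B∩A∈F)
    ...   | inj₂ B─B∩A∈F =
            inj₂ (subst F (p─p∩q≡p─q A B) A─A∩B∈F , subst F (p─p∩q≡p─q B A) B─B∩A∈F)

    core-⊆⊎disjoint : ∀ A C → F A → IsCore F C → C ⊆ A ⊎ C ∩ A ≡ ⊥
    core-⊆⊎disjoint A C A∈F (C∈F , C-minimal) with ∩∈⊎─∈ C A C∈F A∈F
    ... | inj₁ C∩A∈F =
          inj₁ (subst (_⊆ A) (C-minimal (C ∩ A) (p∩q⊆p C A) C∩A∈F) (p∩q⊆q C A))
    ... | inj₂ (C─A∈F , _) =
          inj₂ (subst (λ X → X ∩ A ≡ ⊥) (C-minimal (C ─ A) (p─q⊆p C A) C─A∈F) ([p─q]∩q≡⊥ C A))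

    cores-disjoint : ∀ C D → IsCore F C → IsCore F D → ¬ (C ≡ D) → C ∩ D ≡ ⊥
    cores-disjoint C D C-core D-core@(D∈F , _) C≢D with core-⊆⊎disjoint D C D∈F C-core
    ... | inj₁ C⊆D    = contradiction (core-⊆⇒≡ C-core D-core C⊆D) C≢D
    ... | inj₂ C∩D≡⊥ = C∩D≡⊥

lemma3 : ∀ {ℓ : Level} {n : ℕ} (F : Family ℓ n) → DisjointnessCompliable F →
      ((A B : Subset n) → F A → F B → F (A ∩ B) ⊎ (F (A ─ B) × F (B ─ A)))
    × ((A C : Subset n) → F A → IsCore F C → C ⊆ A ⊎ C ∩ A ≡ ⊥)
    × ((C D : Subset n) → IsCore F C → IsCore F D → ¬ (C ≡ D) → C ∩ D ≡ ⊥)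
lemma3 F compliable =
  ∩∈⊎─∈ compliable , core-⊆⊎disjoint compliable , cores-disjoint compliable
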